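{- For integers $a,b\ge 1$ with $a+b\le n$, $$|\mathcal{T}^{\mathrm{planar}}_{n,v}(a,b)| = \frac{1}{ab}\binom{2a-2}{a-1}\binom{2b-2}{b-1}\binom{2(n-a-b)}{n-a-b}.$$
   Context: $\mathcal{T}^{\mathrm{planar}}_{n,v}$ is the set of pairs $(T,v)$ where $T$ is a rooted binary planar tree (every internal vertex has exactly two children, ordered left and right) with $n$ unlabelled leaves, counted up to planar isomorphism, and $v$ is an internal vertex of $T$. For such $v$, $\ell(v)$ and $r(v)$ denote the numbers of leaves descending from the left and right child of $v$. $\mathcal{T}^{\mathrm{planar}}_{n,v}(a,b) = \{(T,v)\in\mathcal{T}^{\mathrm{planar}}_{n,v} : \ell(v)=a,\ r(v)=b\}$. -}

module Defs where

open import Data.Nat using (ℕ; suc; _+_)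
open import Data.Product using (Σ; _×_)
open import Relation.Binary.PropositionalEquality using (_≡_)

-- Rooted binary planar trees (every internal vertex has an ordered left and
-- right child); leaves are unlabelled. Syntactic equality of this inductive
-- type is exactly planar isomorphism.
data Tree : Set where
  leaf : Tree
  node : Tree → Tree → Tree

leaves : Tree → ℕ
leaves leaf       = 1
leaves (node l r) = leaves l + leaves r

data Internal : Tree → Set where
  here  : ∀ {l r} → Internal (node l r)
  left  : ∀ {l r} → Internal l → Internal (node l r)
  right : ∀ {l r} → Internal r → Internal (node l r)

ℓ : ∀ {T} → Internal T → ℕ
ℓ (here {l} {r}) = leaves l
ℓ (left v)       = ℓ v
ℓ (right v)      = ℓ v

ρ : ∀ {T} → Internal T → ℕ
ρ (here {l} {r}) = leaves r
ρ (left v)       = ρ v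
ρ (right v)      = ρ v

TPlanar : ℕ → ℕ → ℕ → Set
TPlanar n a b =
  Σ Tree λ T → leaves T ≡ n × Σ (Internal T) λ v → ℓ v ≡ a × ρ v ≡ b

{-# OPTIONS --safe #-}
module Submission where

-- Cutting a tree at the vertex v separates the two subtrees below v (with a
-- and b leaves) from the rest, a tree with n − a − b + 1 leaves one of which
-- marks where v was; this is a bijection, so the count is
-- c(a) c(b) (n − a − b + 1) c(n − a − b + 1), with c(m) the number of trees
-- with m leaves. Rémy's bijection (graft a new leaf on either side of one of
-- the 2m − 1 vertices of a tree with m leaves, remembering the new leaf)
-- gives (m + 1) c(m + 1) = 2 (2m − 1) c(m), which both shows that c(m) is
-- finite and yields m c(m) = binom(2m − 2, m − 1).

open import Defs
open import Axiom.UniquenessOfIdentityProofs using (module Decidable⇒UIP)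
open import Data.Empty using (⊥-elim)
open import Data.Fin using (Fin) renaming (zero to fzero; suc to fsuc)
open import Data.Fin.Permutation using (↔⇒≡)
open import Data.Fin.Properties using (+↔⊎; *↔×; 0↔⊥; 1↔⊤) renaming (_≟_ to _≟ᶠ_)
open import Data.Nat using (ℕ; zero; suc; _+_; _*_; _∸_; _≤_; z≤n; s≤s)
open import Data.Nat.Combinatorics using (_C_; nC1≡n; nCk≡nC[n∸k]; nCk+nC[k+1]≡[n+1]C[k+1])
open import Data.Nat.Properties
open import Data.Nat.Tactic.RingSolver using (solve-∀)
open import Data.Product using (Σ; _×_; _,_; proj₁; proj₂; uncurry)
open import Data.Product.Function.Dependent.Propositional using (Σ-↔)
open import Data.Product.Function.NonDependent.Propositional using (_×-↔_)
open import Data.Sum using (_⊎_; inj₁; inj₂)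
open import Data.Sum.Function.Propositional using (_⊎-↔_)
open import Data.Unit using (⊤; tt)
open import Function.Bundles using (_↔_; _⇔_; mk↔ₛ′; mk⇔; Inverse; Equivalence)
open import Function.Properties.Inverse using (↔-sym; ↔-trans; ↔-refl)
open import Function.Related.Propositional using (module EquationalReasoning)
open import Relation.Binary.PropositionalEquality
open import Relation.Nullary using (Dec; yes; no)
open import Relation.Nullary.Irrelevant using (Irrelevant)

private
  variable
    A B : Set
    P Q : A → Set
    k m n : ℕ

×-irrelevant : Irrelevant A → Irrelevant B → Irrelevant (A × B)
×-irrelevant irrA irrB (a , b) (a′ , b′) = cong₂ _,_ (irrA a a′) (irrB b b′)

⇔⇒↔ : Irrelevant A → Irrelevant B → A ⇔ B → A ↔ B
⇔⇒↔ irrA irrB A⇔B =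
  mk↔ₛ′ (Equivalence.to A⇔B) (Equivalence.from A⇔B) (λ _ → irrB _ _) (λ _ → irrA _ _)

Σ-restrict-↔ : (e : A ↔ B) → (∀ {a} → Irrelevant (P a)) → (∀ {b} → Irrelevant (Q b)) →
               (∀ a → P a ⇔ Q (Inverse.to e a)) → Σ A P ↔ Σ B Q
Σ-restrict-↔ e irrP irrQ P⇔Q = Σ-↔ e (⇔⇒↔ irrP irrQ (P⇔Q _))

Σ-fibre-swap : {f : A → ℕ} →
               Σ (Σ A λ a → f a ≡ n) (λ x → P (proj₁ x)) ↔ Σ (Σ A P) (λ y → f (proj₁ y) ≡ n)
Σ-fibre-swap = mk↔ₛ′ (λ ((a , q) , p) → (a , p) , q) (λ ((a , p) , q) → (a , q) , p)
  (λ _ → refl) (λ _ → refl)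

Σ-const-↔ : (∀ a → Fin k ↔ P a) → (A × Fin k) ↔ Σ A P
Σ-const-↔ e = Σ-↔ ↔-refl (e _)

*↔×₃ : ∀ {p q r} → Fin (p * (q * r)) ↔ (Fin p × Fin q × Fin r)
*↔×₃ = ↔-trans *↔× (↔-refl ×-↔ *↔×)

Finite : Set → Set
Finite A = Σ ℕ λ k → Fin k ↔ A

Finite-↔ : Finite A → A ↔ B → Finite B
Finite-↔ (k , e) A↔B = k , ↔-trans e A↔B

Finite-⊎ : Finite A → Finite B → Finite (A ⊎ B)
Finite-⊎ (k , e) (l , f) = k + l , ↔-trans +↔⊎ (e ⊎-↔ f)

Finite-Dec : Dec A → Irrelevant A → Finite A
Finite-Dec (yes a) irr = 1 , ↔-trans 1↔⊤ (mk↔ₛ′ (λ _ → a) (λ _ → tt) (λ _ → irr _ _) (λ _ → refl))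
Finite-Dec (no ¬a) _   = 0 , ↔-trans 0↔⊥ (mk↔ₛ′ (λ ()) ¬a (λ a → ⊥-elim (¬a a)) (λ ()))

Σ-Fin-suc-↔ : (P : Fin (suc n) → Set) →
              (P fzero ⊎ Σ (Fin n) (λ i → P (fsuc i))) ↔ Σ (Fin (suc n)) P
Σ-Fin-suc-↔ P = mk↔ₛ′ to from to∘from (λ { (inj₁ _) → refl ; (inj₂ _) → refl })
  where
  to : _ → Σ (Fin _) P
  to (inj₁ p) = fzero , p
  to (inj₂ (i , p)) = fsuc i , p
  from : Σ (Fin _) P → _
  from (fzero , p) = inj₁ p
  from (fsuc i , p) = inj₂ (i , p)
  to∘from : ∀ x → to (from x) ≡ x
  to∘from (fzero , _) = refl
  to∘from (fsuc _ , _) = refl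

Finite-Σ-Fin : (P : Fin n → Set) → (∀ i → Dec (P i)) → (∀ i → Irrelevant (P i)) →
               Finite (Σ (Fin n) P)
Finite-Σ-Fin {zero}  P P? irr = 0 , mk↔ₛ′ (λ ()) (λ ()) (λ ()) (λ ())
Finite-Σ-Fin {suc n} P P? irr = Finite-↔
  (Finite-⊎ (Finite-Dec (P? fzero) (irr fzero))
            (Finite-Σ-Fin (λ i → P (fsuc i)) (λ i → P? (fsuc i)) (λ i → irr (fsuc i))))
  (Σ-Fin-suc-↔ P)

×-Fin-cancel : Fin k ↔ (A × Fin (suc m)) → Finite A
×-Fin-cancel {A = A} {m = m} e = Finite-↔
  (Finite-Σ-Fin (λ i → proj₂ (Inverse.to e i) ≡ fzero) (λ i → proj₂ (Inverse.to e i) ≟ᶠ fzero)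
    (λ i → Decidable⇒UIP.≡-irrelevant _≟ᶠ_))
  (↔-trans (Σ-↔ e ↔-refl) first-column)
  where
  first-column : Σ (A × Fin (suc m)) (λ x → proj₂ x ≡ fzero) ↔ A
  first-column = mk↔ₛ′ (λ x → proj₁ (proj₁ x)) (λ a → (a , fzero) , refl)
    (λ _ → refl) (λ { ((_ , _) , refl) → refl })

Trees : ℕ → Set
Trees n = Σ Tree λ T → leaves T ≡ n

data Leaf : Tree → Set where
  here  : Leaf leaf
  left  : ∀ {l r} → Leaf l → Leaf (node l r)
  right : ∀ {l r} → Leaf r → Leaf (node l r)

data Vertex : Tree → Set where
  root  : ∀ {T} → Vertex T
  left  : ∀ {l r} → Vertex l → Vertex (node l r)
  right : ∀ {l r} → Vertex r → Vertex (node l r)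

vertices : Tree → ℕ
vertices leaf       = 1
vertices (node l r) = suc (vertices l + vertices r)

leaf-enum : ∀ T → Fin (leaves T) ↔ Leaf T
leaf-enum leaf       = ↔-trans 1↔⊤ (mk↔ₛ′ (λ _ → here) (λ _ → tt) (λ { here → refl }) (λ _ → refl))
leaf-enum (node l r) = ↔-trans +↔⊎ (↔-trans (leaf-enum l ⊎-↔ leaf-enum r) (mk↔ₛ′
  (λ { (inj₁ p) → left p ; (inj₂ p) → right p }) (λ { (left p) → inj₁ p ; (right p) → inj₂ p })
  (λ { (left _) → refl ; (right _) → refl }) (λ { (inj₁ _) → refl ; (inj₂ _) → refl })))

vertex-enum : ∀ T → Fin (vertices T) ↔ Vertex T
vertex-enum leaf       = ↔-trans 1↔⊤ (mk↔ₛ′ (λ _ → root) (λ _ → tt) (λ { root → refl }) (λ _ → refl))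
vertex-enum (node l r) = ↔-trans (+↔⊎ {1})
  (↔-trans (1↔⊤ ⊎-↔ ↔-trans +↔⊎ (vertex-enum l ⊎-↔ vertex-enum r)) (mk↔ₛ′
  (λ { (inj₁ _) → root ; (inj₂ (inj₁ p)) → left p ; (inj₂ (inj₂ p)) → right p })
  (λ { root → inj₁ tt ; (left p) → inj₂ (inj₁ p) ; (right p) → inj₂ (inj₂ p) })
  (λ { root → refl ; (left _) → refl ; (right _) → refl })
  (λ { (inj₁ _) → refl ; (inj₂ (inj₁ _)) → refl ; (inj₂ (inj₂ _)) → refl })))

1≤leaves : ∀ T → 1 ≤ leaves T
1≤leaves leaf       = s≤s z≤n
1≤leaves (node l r) = ≤-trans (1≤leaves l) (m≤m+n (leaves l) (leaves r))

vertices+1≡2*leaves : ∀ T → vertices T + 1 ≡ 2 * leaves T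
vertices+1≡2*leaves leaf       = refl
vertices+1≡2*leaves (node l r) = begin
  suc (vertices l + vertices r) + 1
    ≡⟨ rearrange (vertices l) (vertices r) ⟩
  (vertices l + 1) + (vertices r + 1)
    ≡⟨ cong₂ _+_ (vertices+1≡2*leaves l) (vertices+1≡2*leaves r) ⟩
  2 * leaves l + 2 * leaves r
    ≡⟨ *-distribˡ-+ 2 (leaves l) (leaves r) ⟨
  2 * (leaves l + leaves r)
    ∎
  where
  open ≡-Reasoning
  rearrange : ∀ x y → suc (x + y) + 1 ≡ (x + 1) + (y + 1)
  rearrange = solve-∀

vertices-of-size : ∀ {m T} → leaves T ≡ suc m → vertices T ≡ suc (2 * m)
vertices-of-size {m} {T} eq = +-cancelʳ-≡ 1 _ _ (begin
  vertices T + 1  ≡⟨ vertices+1≡2*leaves T ⟩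
  2 * leaves T    ≡⟨ cong (2 *_) eq ⟩
  2 * suc m       ≡⟨ *-suc 2 m ⟩
  1 + suc (2 * m) ≡⟨ +-comm 1 (suc (2 * m)) ⟩
  suc (2 * m) + 1 ∎)
  where open ≡-Reasoning

Pointed : ℕ → Set
Pointed n = Σ (Trees n) λ x → Leaf (proj₁ x)

pointed-↔ : (Trees n × Fin n) ↔ Pointed n
pointed-↔ = Σ-const-↔ λ { (T , refl) → leaf-enum T }

GraftSite : Set
GraftSite = Σ Tree λ T → Vertex T × Fin 2

MarkedFork : Set
MarkedFork = Σ (Tree × Tree) λ lr → Leaf (uncurry node lr)

graftˡ : Tree → MarkedFork → MarkedFork
graftˡ r ((a , b) , p) = (node a b , r) , left p

graftʳ : Tree → MarkedFork → MarkedFork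
graftʳ l ((a , b) , p) = (l , node a b) , right p

-- The new leaf becomes the left (0) or right (1) sibling of the subtree at the vertex.
graft : GraftSite → MarkedFork
graft (T , root , fzero)          = (leaf , T) , left here
graft (T , root , fsuc fzero)     = (T , leaf) , right here
graft (node l r , left u , s)     = graftˡ r (graft (l , u , s))
graft (node l r , right u , s)    = graftʳ l (graft (r , u , s))

pruneˡ : Tree → GraftSite → GraftSite
pruneˡ r (T , u , s) = node T r , left u , s

pruneʳ : Tree → GraftSite → GraftSite
pruneʳ l (T , u , s) = node l T , right u , s

prune′ : ∀ l r → Leaf (node l r) → GraftSite
prune′ leaf       r    (left here)  = r , root , fzero
prune′ (node a b) r    (left p)     = pruneˡ r (prune′ a b p)
prune′ l          leaf (right here) = l , root , fsuc fzero
prune′ l (node a b)    (right p)    = pruneʳ l (prune′ a b p)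

prune : MarkedFork → GraftSite
prune ((l , r) , p) = prune′ l r p

prune-graft : ∀ s → prune (graft s) ≡ s
prune-graft (T , root , fzero)                = refl
prune-graft (leaf , root , fsuc fzero)        = refl
prune-graft (node _ _ , root , fsuc fzero)    = refl
prune-graft (node l r , left u , s)           = cong (pruneˡ r) (prune-graft (l , u , s))
prune-graft (node leaf r , right u , s)       = cong (pruneʳ leaf) (prune-graft (r , u , s))
prune-graft (node (node a b) r , right u , s) = cong (pruneʳ (node a b)) (prune-graft (r , u , s))

graft-prune′ : ∀ l r p → graft (prune′ l r p) ≡ ((l , r) , p)
graft-prune′ leaf       r          (left here)  = refl
graft-prune′ (node a b) r          (left p)     = cong (graftˡ r) (graft-prune′ a b p)
graft-prune′ leaf       leaf       (right here) = refl
graft-prune′ (node _ _) leaf       (right here) = refl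
graft-prune′ leaf       (node a b) (right p)    = cong (graftʳ leaf) (graft-prune′ a b p)
graft-prune′ (node c d) (node a b) (right p)    = cong (graftʳ (node c d)) (graft-prune′ a b p)

graft-↔ : GraftSite ↔ MarkedFork
graft-↔ = mk↔ₛ′ graft prune (λ ((l , r) , p) → graft-prune′ l r p) prune-graft

graft-leaves : ∀ s → leaves (uncurry node (proj₁ (graft s))) ≡ suc (leaves (proj₁ s))
graft-leaves (T , root , fzero)         = refl
graft-leaves (T , root , fsuc fzero)    = +-comm (leaves T) 1
graft-leaves (node l r , left u , s)    = cong (_+ leaves r) (graft-leaves (l , u , s))
graft-leaves (node l r , right u , s)   =
  trans (cong (leaves l +_) (graft-leaves (r , u , s))) (+-suc (leaves l) (leaves r))

grafts-of-size-↔ : Σ GraftSite (λ s → leaves (proj₁ s) ≡ suc m) ↔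
                   Σ MarkedFork (λ f → leaves (uncurry node (proj₁ f)) ≡ suc (suc m))
grafts-of-size-↔ = Σ-restrict-↔ graft-↔ ≡-irrelevant ≡-irrelevant λ s → mk⇔
  (λ q → trans (graft-leaves s) (cong suc q))
  (λ q → suc-injective (trans (sym (graft-leaves s)) q))

forks-↔ : Σ MarkedFork (λ f → leaves (uncurry node (proj₁ f)) ≡ suc (suc m)) ↔
          Pointed (suc (suc m))
forks-↔ = mk↔ₛ′ (λ (((l , r) , p) , q) → (node l r , q) , p) from
  (λ { ((leaf , ()) , _) ; ((node _ _ , _) , _) → refl }) (λ _ → refl)
  where
  from : Pointed (suc (suc m)) → Σ MarkedFork (λ f → leaves (uncurry node (proj₁ f)) ≡ suc (suc m))
  from ((node l r , q) , p) = ((l , r) , p) , q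

sites-↔ : (Trees (suc m) × Fin (suc (2 * m) * 2)) ↔
          Σ (Trees (suc m)) (λ x → Vertex (proj₁ x) × Fin 2)
sites-↔ = Σ-const-↔ λ (T , q) →
  ↔-trans *↔× (subst (λ k → Fin k ↔ Vertex T) (vertices-of-size q) (vertex-enum T) ×-↔ ↔-refl)

remy-↔ : (Trees (suc m) × Fin (suc (2 * m) * 2)) ↔ (Trees (suc (suc m)) × Fin (suc (suc m)))
remy-↔ {m} = begin
  (Trees (suc m) × Fin (suc (2 * m) * 2))                              ↔⟨ sites-↔ ⟩
  Σ (Trees (suc m)) (λ x → Vertex (proj₁ x) × Fin 2)                   ↔⟨ Σ-fibre-swap ⟩
  Σ GraftSite (λ s → leaves (proj₁ s) ≡ suc m)                         ↔⟨ grafts-of-size-↔ ⟩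
  Σ MarkedFork (λ f → leaves (uncurry node (proj₁ f)) ≡ suc (suc m))  ↔⟨ forks-↔ ⟩
  Pointed (suc (suc m))                                                ↔⟨ pointed-↔ ⟨
  (Trees (suc (suc m)) × Fin (suc (suc m)))                            ∎
  where open EquationalReasoning

single-leaf-↔ : Fin 1 ↔ Trees 1
single-leaf-↔ = ↔-trans 1↔⊤ (mk↔ₛ′ (λ _ → leaf , refl) (λ _ → tt) unique (λ _ → refl))
  where
  unique : ∀ x → (leaf , refl) ≡ x
  unique (leaf , refl) = refl
  unique (node l r , eq) with s≤s () ← subst (2 ≤_) eq (+-mono-≤ (1≤leaves l) (1≤leaves r))

trees-finite : ∀ m → Finite (Trees (suc m))
trees-finite zero    = 1 , single-leaf-↔
trees-finite (suc m) =
  ×-Fin-cancel (↔-trans *↔× (↔-trans (proj₂ (trees-finite m) ×-↔ ↔-refl) remy-↔))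

catalan : ℕ → ℕ
catalan m = proj₁ (trees-finite m)

trees-enum : ∀ m → Fin (catalan m) ↔ Trees (suc m)
trees-enum m = proj₂ (trees-finite m)

pointed-enum : ∀ m → Fin (catalan m * suc m) ↔ Pointed (suc m)
pointed-enum m = ↔-trans *↔× (↔-trans (trees-enum m ×-↔ ↔-refl) pointed-↔)

catalan-remy : ∀ m → catalan (suc m) * suc (suc m) ≡ catalan m * (suc (2 * m) * 2)
catalan-remy m = ↔⇒≡ (↔-trans *↔× (↔-trans (trees-enum (suc m) ×-↔ ↔-refl)
  (↔-sym (↔-trans *↔× (↔-trans (trees-enum m ×-↔ ↔-refl) remy-↔)))))

[1+k]*[1+n]C[1+k]≡[1+n]*nCk : ∀ n k → suc k * (suc n C suc k) ≡ suc n * (n C k)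
[1+k]*[1+n]C[1+k]≡[1+n]*nCk n       zero    =
  trans (*-identityˡ (suc n C 1)) (trans (nC1≡n (suc n)) (sym (*-identityʳ (suc n))))
[1+k]*[1+n]C[1+k]≡[1+n]*nCk zero    (suc k) = *-zeroʳ (suc (suc k))
[1+k]*[1+n]C[1+k]≡[1+n]*nCk (suc n) (suc k) = begin
  suc (suc k) * (suc (suc n) C suc (suc k))
    ≡⟨ cong (suc (suc k) *_) (nCk+nC[k+1]≡[n+1]C[k+1] (suc n) (suc k)) ⟨
  suc (suc k) * (X + Y)
    ≡⟨ rearrange (suc k) X Y ⟩
  X + (suc k * X + suc (suc k) * Y)
    ≡⟨ cong (X +_) (cong₂ _+_ ([1+k]*[1+n]C[1+k]≡[1+n]*nCk n k) ([1+k]*[1+n]C[1+k]≡[1+n]*nCk n (suc k))) ⟩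
  X + (suc n * (n C k) + suc n * (n C suc k))
    ≡⟨ cong (X +_) (*-distribˡ-+ (suc n) (n C k) (n C suc k)) ⟨
  X + suc n * (n C k + n C suc k)
    ≡⟨ cong (λ t → X + suc n * t) (nCk+nC[k+1]≡[n+1]C[k+1] n k) ⟩
  X + suc n * X
    ∎
  where
  open ≡-Reasoning
  X = suc n C suc k
  Y = suc n C suc (suc k)
  rearrange : ∀ s x y → suc s * (x + y) ≡ x + (s * x + suc s * y)
  rearrange = solve-∀

[1+2k]Ck≡[1+2k]C[1+k] : ∀ k → suc (2 * k) C k ≡ suc (2 * k) C suc k
[1+2k]Ck≡[1+2k]C[1+k] k = trans (nCk≡nC[n∸k] k≤1+2k) (cong (suc (2 * k) C_) (begin
  suc (2 * k) ∸ k ≡⟨ cong (λ t → suc t ∸ k) (cong (k +_) (+-identityʳ k)) ⟩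
  suc (k + k) ∸ k ≡⟨ cong (_∸ k) (+-suc k k) ⟨
  k + suc k ∸ k   ≡⟨ m+n∸m≡n k (suc k) ⟩
  suc k           ∎))
  where
  open ≡-Reasoning
  k≤1+2k : k ≤ suc (2 * k)
  k≤1+2k = m≤n⇒m≤1+n (m≤m+n k (k + 0))

central-binomial-step : ∀ k → suc k * ((2 * suc k) C suc k) ≡ 2 * (suc (2 * k) * ((2 * k) C k))
central-binomial-step k = begin
  suc k * ((2 * suc k) C suc k)                ≡⟨ cong (λ t → suc k * (t C suc k)) (*-suc 2 k) ⟩
  suc k * (suc N C suc k)                     ≡⟨ cong (suc k *_) (nCk+nC[k+1]≡[n+1]C[k+1] N k) ⟨
  suc k * (N C k + N C suc k)                 ≡⟨ cong (λ t → suc k * (t + N C suc k)) ([1+2k]Ck≡[1+2k]C[1+k] k) ⟩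
  suc k * (N C suc k + N C suc k)             ≡⟨ double (suc k) (N C suc k) ⟩
  2 * (suc k * (N C suc k))                   ≡⟨ cong (2 *_) ([1+k]*[1+n]C[1+k]≡[1+n]*nCk (2 * k) k) ⟩
  2 * (N * ((2 * k) C k))                     ∎
  where
  open ≡-Reasoning
  N = suc (2 * k)
  double : ∀ s y → s * (y + y) ≡ 2 * (s * y)
  double = solve-∀

catalan*[1+m]≡2mCm : ∀ m → catalan m * suc m ≡ (2 * m) C m
catalan*[1+m]≡2mCm zero    = refl
catalan*[1+m]≡2mCm (suc m) = *-cancelˡ-≡ _ _ (suc m) (begin
  suc m * (catalan (suc m) * suc (suc m))  ≡⟨ cong (suc m *_) (catalan-remy m) ⟩
  suc m * (catalan m * (suc (2 * m) * 2))  ≡⟨ rearrange (suc m) (catalan m) (suc (2 * m)) ⟩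
  2 * (suc (2 * m) * (catalan m * suc m))  ≡⟨ cong (λ t → 2 * (suc (2 * m) * t)) (catalan*[1+m]≡2mCm m) ⟩
  2 * (suc (2 * m) * ((2 * m) C m))        ≡⟨ central-binomial-step m ⟨
  suc m * ((2 * suc m) C suc m)            ∎)
  where
  open ≡-Reasoning
  rearrange : ∀ s c n → s * (c * (n * 2)) ≡ 2 * (n * (c * s))
  rearrange = solve-∀

Context : Set
Context = Σ Tree Leaf

Split : Set
Split = Tree × Tree × Context

fillˡ : Tree → Σ Tree Internal → Σ Tree Internal
fillˡ r (T , v) = node T r , left v

fillʳ : Tree → Σ Tree Internal → Σ Tree Internal
fillʳ l (T , v) = node l T , right v

fill′ : Tree → Tree → (c : Tree) → Leaf c → Σ Tree Internal
fill′ x y leaf       here      = node x y , here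
fill′ x y (node c r) (left h)  = fillˡ r (fill′ x y c h)
fill′ x y (node l c) (right h) = fillʳ l (fill′ x y c h)

fill : Split → Σ Tree Internal
fill (x , y , c , h) = fill′ x y c h

cutˡ : Tree → Split → Split
cutˡ r (x , y , c , h) = x , y , node c r , left h

cutʳ : Tree → Split → Split
cutʳ l (x , y , c , h) = x , y , node l c , right h

cut : (T : Tree) → Internal T → Split
cut (node l r) here      = l , r , leaf , here
cut (node l r) (left v)  = cutˡ r (cut l v)
cut (node l r) (right v) = cutʳ l (cut r v)

fill-cut : ∀ T v → fill (cut T v) ≡ (T , v)
fill-cut (node l r) here      = refl
fill-cut (node l r) (left v)  = cong (fillˡ r) (fill-cut l v)
fill-cut (node l r) (right v) = cong (fillʳ l) (fill-cut r v)

cut-fill′ : ∀ x y c h → uncurry cut (fill′ x y c h) ≡ (x , y , c , h)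
cut-fill′ x y leaf       here      = refl
cut-fill′ x y (node c r) (left h)  = cong (cutˡ r) (cut-fill′ x y c h)
cut-fill′ x y (node l c) (right h) = cong (cutʳ l) (cut-fill′ x y c h)

fill-↔ : Split ↔ Σ Tree Internal
fill-↔ = mk↔ₛ′ fill (uncurry cut) (uncurry fill-cut) (λ (x , y , c , h) → cut-fill′ x y c h)

fill′-ℓ : ∀ x y c h → ℓ (proj₂ (fill′ x y c h)) ≡ leaves x
fill′-ℓ x y leaf       here      = refl
fill′-ℓ x y (node c r) (left h)  = fill′-ℓ x y c h
fill′-ℓ x y (node l c) (right h) = fill′-ℓ x y c h

fill′-ρ : ∀ x y c h → ρ (proj₂ (fill′ x y c h)) ≡ leaves y
fill′-ρ x y leaf       here      = refl
fill′-ρ x y (node c r) (left h)  = fill′-ρ x y c h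
fill′-ρ x y (node l c) (right h) = fill′-ρ x y c h

fill′-leaves : ∀ x y c h → leaves x + leaves y + leaves c ≡ suc (leaves (proj₁ (fill′ x y c h)))
fill′-leaves x y leaf       here      = +-comm (leaves x + leaves y) 1
fill′-leaves x y (node c r) (left h)  = begin
  X + Y + (leaves c + leaves r) ≡⟨ +-assoc (X + Y) (leaves c) (leaves r) ⟨
  X + Y + leaves c + leaves r   ≡⟨ cong (_+ leaves r) (fill′-leaves x y c h) ⟩
  suc (leaves T + leaves r)     ∎
  where
  open ≡-Reasoning
  X = leaves x
  Y = leaves y
  T = proj₁ (fill′ x y c h)
fill′-leaves x y (node l c) (right h) = begin
  X + Y + (leaves l + leaves c) ≡⟨ rearrange X Y (leaves l) (leaves c) ⟩
  leaves l + (X + Y + leaves c) ≡⟨ cong (leaves l +_) (fill′-leaves x y c h) ⟩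
  leaves l + suc (leaves T)     ≡⟨ +-suc (leaves l) (leaves T) ⟩
  suc (leaves l + leaves T)     ∎
  where
  open ≡-Reasoning
  X = leaves x
  Y = leaves y
  T = proj₁ (fill′ x y c h)
  rearrange : ∀ p q r s → p + q + (r + s) ≡ r + (p + q + s)
  rearrange = solve-∀

m+c≡1+n⇔c≡1+[n∸m] : ∀ {m n c} → m ≤ n → (m + c ≡ suc n) ⇔ (c ≡ suc (n ∸ m))
m+c≡1+n⇔c≡1+[n∸m] {m} {n} {c} m≤n = mk⇔
  (λ eq → trans (sym (m+n∸m≡n m c)) (trans (cong (_∸ m) eq) (+-∸-assoc 1 m≤n)))
  (λ eq → trans (cong (m +_) eq) (trans (+-suc m (n ∸ m)) (cong suc (m+[n∸m]≡n m≤n))))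

SplitSizes : ℕ → ℕ → ℕ → Split → Set
SplitSizes a b e (x , y , c , _) = leaves x ≡ a × leaves y ≡ b × leaves c ≡ e

VertexSizes : ℕ → ℕ → ℕ → Σ Tree Internal → Set
VertexSizes n a b (T , v) = leaves T ≡ n × ℓ v ≡ a × ρ v ≡ b

fill-sizes : ∀ {n a b} → a + b ≤ n → ∀ s → SplitSizes a b (suc (n ∸ a ∸ b)) s ⇔ VertexSizes n a b (fill s)
fill-sizes {n} {a} {b} a+b≤n (x , y , c , h) = mk⇔
  (λ (qx , qy , qc) →
    suc-injective (trans (sym (total qx qy)) (Equivalence.from sizes qc)) ,
    trans (fill′-ℓ x y c h) qx , trans (fill′-ρ x y c h) qy)
  (λ (qT , qℓ , qρ) →
    let qx = trans (sym (fill′-ℓ x y c h)) qℓ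
        qy = trans (sym (fill′-ρ x y c h)) qρ
    in qx , qy , Equivalence.to sizes (trans (total qx qy) (cong suc qT)))
  where
  sizes : (a + b + leaves c ≡ suc n) ⇔ (leaves c ≡ suc (n ∸ a ∸ b))
  sizes = subst (λ t → (a + b + leaves c ≡ suc n) ⇔ (leaves c ≡ suc t)) (sym (∸-+-assoc n a b))
    (m+c≡1+n⇔c≡1+[n∸m] a+b≤n)
  total : leaves x ≡ a → leaves y ≡ b → a + b + leaves c ≡ suc (leaves (proj₁ (fill′ x y c h)))
  total qx qy = trans (cong₂ (λ p q → p + q + leaves c) (sym qx) (sym qy)) (fill′-leaves x y c h)

TPlanar-↔ : ∀ {n a b} → TPlanar n a b ↔ Σ (Σ Tree Internal) (VertexSizes n a b)
TPlanar-↔ = mk↔ₛ′ (λ (T , q , v , qs) → (T , v) , q , qs) (λ ((T , v) , q , qs) → T , q , v , qs)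
  (λ _ → refl) (λ _ → refl)

SplitSizes-↔ : ∀ {a b e} → Σ Split (SplitSizes a b e) ↔ (Trees a × Trees b × Pointed e)
SplitSizes-↔ = mk↔ₛ′
  (λ ((x , y , c , h) , qx , qy , qc) → (x , qx) , (y , qy) , (c , qc) , h)
  (λ ((x , qx) , (y , qy) , (c , qc) , h) → (x , y , c , h) , qx , qy , qc)
  (λ _ → refl) (λ _ → refl)

planar-↔ : ∀ {n a b} → a + b ≤ n → TPlanar n a b ↔ (Trees a × Trees b × Pointed (suc (n ∸ a ∸ b)))
planar-↔ {n} {a} {b} a+b≤n = begin
  TPlanar n a b                                    ↔⟨ TPlanar-↔ ⟩
  Σ (Σ Tree Internal) (VertexSizes n a b)          ↔⟨ Σ-restrict-↔ fill-↔ irr₃ irr₃ (fill-sizes a+b≤n) ⟨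
  Σ Split (SplitSizes a b (suc (n ∸ a ∸ b)))       ↔⟨ SplitSizes-↔ ⟩
  (Trees a × Trees b × Pointed (suc (n ∸ a ∸ b)))  ∎
  where
  open EquationalReasoning
  irr₃ : ∀ {i j k l m o : ℕ} → Irrelevant (i ≡ j × k ≡ l × m ≡ o)
  irr₃ = ×-irrelevant ≡-irrelevant (×-irrelevant ≡-irrelevant ≡-irrelevant)

2*[1+m]∸2≡2*m : ∀ m → 2 * suc m ∸ 2 ≡ 2 * m
2*[1+m]∸2≡2*m m = cong (_∸ 2) (*-suc 2 m)

lemma6p8 : (n a b : ℕ) → 1 ≤ a → 1 ≤ b → a + b ≤ n →
    Σ ℕ λ k → (Fin k ↔ TPlanar n a b) ×
    (k * (a * b) ≡ ((2 * a ∸ 2) C (a ∸ 1)) * ((2 * b ∸ 2) C (b ∸ 1)) * ((2 * (n ∸ a ∸ b)) C (n ∸ a ∸ b)))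
lemma6p8 n (suc a) (suc b) (s≤s _) (s≤s _) a+b≤n = catalan a * (catalan b * (catalan d * suc d)) , enum , count
  where
  d = n ∸ suc a ∸ suc b

  enum : Fin (catalan a * (catalan b * (catalan d * suc d))) ↔ TPlanar n (suc a) (suc b)
  enum = ↔-trans *↔×₃ (↔-trans (trees-enum a ×-↔ (trees-enum b ×-↔ pointed-enum d)) (↔-sym (planar-↔ a+b≤n)))

  rearrange : ∀ p q r x y → p * (q * r) * (x * y) ≡ p * x * (q * y) * r
  rearrange = solve-∀

  open ≡-Reasoning
  count : catalan a * (catalan b * (catalan d * suc d)) * (suc a * suc b)
        ≡ ((2 * suc a ∸ 2) C a) * ((2 * suc b ∸ 2) C b) * ((2 * d) C d)
  count = begin
    catalan a * (catalan b * (catalan d * suc d)) * (suc a * suc b)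
      ≡⟨ rearrange (catalan a) (catalan b) (catalan d * suc d) (suc a) (suc b) ⟩
    catalan a * suc a * (catalan b * suc b) * (catalan d * suc d)
      ≡⟨ cong₂ _*_ (cong₂ _*_ (catalan*[1+m]≡2mCm a) (catalan*[1+m]≡2mCm b)) (catalan*[1+m]≡2mCm d) ⟩
    ((2 * a) C a) * ((2 * b) C b) * ((2 * d) C d)
      ≡⟨ cong₂ (λ p q → (p C a) * (q C b) * ((2 * d) C d)) (2*[1+m]∸2≡2*m a) (2*[1+m]∸2≡2*m b) ⟨
    ((2 * suc a ∸ 2) C a) * ((2 * suc b ∸ 2) C b) * ((2 * d) C d)
      ∎
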